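{- For the complete graph $K_n$ with $n\ge 3$, the star $K_{1,n-1}$ with $n\geq 3$, and the wheel $W_n$ with $n\geq 4$, we have $\mathrm{msd}_{\gamma_t}(K_n)=\mathrm{msd}_{\gamma_t}(K_{1,n-1})=\mathrm{msd}_{\gamma_t}(W_n)=2$.
   Context: The wheel $W_n$ consists of a cycle together with one additional vertex adjacent to all vertices of the cycle. A set $S\subseteq V(G)$ is a total dominating set of $G$ if every vertex of $G$ is adjacent to a vertex of $S$; $\gamma_t(G)$ is the minimum size of such a set. For an edge $e=uv$ and integer $t\ge1$, $G_{e,t}$ denotes the graph obtained from $G$ by replacing the edge $uv$ by a path $(u,x_1,\dots,x_t,v)$ with $t$ new vertices. $\mathrm{msd}_{\gamma_t}(uv)$ is the minimum positive integer $t$ such that $\gamma_t(G_{uv,t})>\gamma_t(G)$, and $\mathrm{msd}_{\gamma_t}(G)=\min\{\mathrm{msd}_{\gamma_t}(uv): uv\in E(G)\}$. -}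

module Defs where

open import Data.Nat using (ℕ; zero; suc; _+_; _∸_; _≤_; _<_)
open import Data.Nat.Base using (_≡ᵇ_)
open import Data.Fin using (Fin; toℕ; splitAt; _≟_)
open import Data.Fin.Subset using (Subset; _∈_; ∣_∣)
open import Data.Bool using (Bool; true; false; _∧_; _∨_; not)
open import Data.Sum using (_⊎_; inj₁; inj₂)
open import Data.Product using (Σ; ∃; _×_; _,_)
open import Relation.Nullary using (¬_)
open import Relation.Nullary.Decidable using (⌊_⌋)
open import Relation.Binary.PropositionalEquality using (_≡_)

-- A (finite simple) graph on the vertex set Fin n, given by a Boolean
-- adjacency function.  All concrete graphs below are symmetric and
-- irreflexive by construction.
Graph : ℕ → Set
Graph n = Fin n → Fin n → Bool

Adj : {n : ℕ} → Graph n → Fin n → Fin n → Set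
Adj G x y = G x y ≡ true

IsTDS : {n : ℕ} → Graph n → Subset n → Set
IsTDS {n} G S = (x : Fin n) → ∃ λ y → (y ∈ S) × Adj G x y

GammaT : {n : ℕ} → Graph n → ℕ → Set
GammaT {n} G k =
  (Σ (Subset n) λ S → IsTDS G S × ∣ S ∣ ≡ k) ×
  ((S : Subset n) → IsTDS G S → k ≤ ∣ S ∣)

-- G_{uv,t}: replace edge uv by the path u, x_1, ..., x_t, v.
-- Old vertices are Fin n (first block), the new vertex x_{i+1} is the
-- i-th element of the second block Fin t.
subdivide : {n : ℕ} → Graph n → Fin n → Fin n → (t : ℕ) → Graph (n + t)
subdivide {n} G u v t a b with splitAt n a | splitAt n b
... | inj₁ a' | inj₁ b' =
  G a' b' ∧ not ((⌊ a' ≟ u ⌋ ∧ ⌊ b' ≟ v ⌋) ∨ (⌊ a' ≟ v ⌋ ∧ ⌊ b' ≟ u ⌋))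
... | inj₁ a' | inj₂ j =
  (⌊ a' ≟ u ⌋ ∧ (toℕ j ≡ᵇ 0)) ∨ (⌊ a' ≟ v ⌋ ∧ (toℕ j ≡ᵇ (t ∸ 1)))
... | inj₂ i | inj₁ b' =
  (⌊ b' ≟ u ⌋ ∧ (toℕ i ≡ᵇ 0)) ∨ (⌊ b' ≟ v ⌋ ∧ (toℕ i ≡ᵇ (t ∸ 1)))
... | inj₂ i | inj₂ j =
  (suc (toℕ i) ≡ᵇ toℕ j) ∨ (suc (toℕ j) ≡ᵇ toℕ i)

Increases : {n : ℕ} → Graph n → Fin n → Fin n → ℕ → Set
Increases G u v t =
  ∃ λ a → ∃ λ b → GammaT (subdivide G u v t) a × GammaT G b × b < a

MsdEdge : {n : ℕ} → Graph n → Fin n → Fin n → ℕ → Set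
MsdEdge G u v t =
  1 ≤ t × Increases G u v t ×
  ((s : ℕ) → 1 ≤ s → s < t → ¬ Increases G u v s)

Msd : {n : ℕ} → Graph n → ℕ → Set
Msd {n} G m =
  ((u v : Fin n) → Adj G u v → Σ ℕ λ t → MsdEdge G u v t × m ≤ t) ×
  (∃ λ u → ∃ λ v → Adj G u v × MsdEdge G u v m)

complete : (n : ℕ) → Graph n
complete n a b = not ⌊ a ≟ b ⌋

star : (n : ℕ) → Graph n
star n a b = ((toℕ a ≡ᵇ 0) ∧ not (toℕ b ≡ᵇ 0)) ∨ ((toℕ b ≡ᵇ 0) ∧ not (toℕ a ≡ᵇ 0))

-- Wheel W_n on Fin n (n vertices): hub 0, cycle 1,2,...,n-1,1.
wheel : (n : ℕ) → Graph n
wheel n a b =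
  ((toℕ a ≡ᵇ 0) ∧ not (toℕ b ≡ᵇ 0)) ∨ ((toℕ b ≡ᵇ 0) ∧ not (toℕ a ≡ᵇ 0)) ∨
  (not (toℕ a ≡ᵇ 0) ∧ not (toℕ b ≡ᵇ 0) ∧
    ((suc (toℕ a) ≡ᵇ toℕ b) ∨ (suc (toℕ b) ≡ᵇ toℕ a) ∨
     ((toℕ a ≡ᵇ 1) ∧ (toℕ b ≡ᵇ (n ∸ 1))) ∨ ((toℕ b ≡ᵇ 1) ∧ (toℕ a ≡ᵇ (n ∸ 1)))))

-- A graph with a universal vertex c has γₜ = 2, witnessed by c and any other vertex.
-- Subdividing an edge uv once leaves a total dominating set of size 2 ({c, x₁} if c is an
-- end of uv, {c, u} otherwise), so γₜ does not grow. After subdividing twice,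
-- {c, x₁, x₂} resp. {c, u, v} is a total dominating set, but two vertices no longer
-- suffice, so γₜ becomes 3. K_n, K_{1,n-1} and W_n all have a universal vertex.
module Submission where

open import Defs
open import Data.Nat using (ℕ; zero; suc; _+_; _∸_; _≤_; _<_; z≤n; s≤s)
open import Data.Nat.Base using (_≡ᵇ_)
open import Data.Nat.Properties
  using (≡ᵇ⇒≡; ≡⇒≡ᵇ; 1+n≢n; ≤-refl; ≤-trans; ≤-antisym; <⇒≱; +-monoʳ-≤; +-suc; n≤1+n)
open import Data.Fin using (Fin; zero; suc; toℕ; splitAt; _≟_; _↑ˡ_; _↑ʳ_)
open import Data.Fin.Properties
  using (splitAt-↑ˡ; splitAt-↑ʳ; splitAt⁻¹-↑ˡ; splitAt⁻¹-↑ʳ; ↑ˡ-injective; ↑ʳ-injective)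
open import Data.Fin.Subset using (Subset; _∈_; ∣_∣; ⁅_⁆; _∪_; inside; outside)
open import Data.Fin.Subset.Properties
  using (x∈⁅x⁆; p⊆p∪q; q⊆p∪q; ∣⁅x⁆∣≡1; x∈p⇒∣p-x∣<∣p∣; x∈p∧x≢y⇒x∈p-y)
open import Data.Vec using (_∷_; [])
open import Data.Bool using (true; false; T; _∧_; _∨_; not)
open import Data.Bool.Properties using (T-≡; T-∧; T-∨)
open import Data.Sum using (_⊎_; inj₁; inj₂; [_,_]′; map)
open import Data.Sum.Function.Propositional using (_⊎-⇔_)
open import Data.Product using (Σ; ∃; _×_; _,_; proj₁; proj₂)
open import Data.Product.Function.NonDependent.Propositional using (_×-⇔_)
open import Function using (_∘_; case_of_; _⇔_; mk⇔; Equivalence)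
open import Function.Construct.Composition using (_⇔-∘_)
open import Relation.Nullary using (¬_; yes; no; contradiction)
open import Relation.Nullary.Decidable using (⌊_⌋; toWitness; fromWitness)
open import Relation.Binary.PropositionalEquality
  using (_≡_; _≢_; refl; sym; trans; cong; cong₂; subst)

open Equivalence using (to; from)

private
  variable
    n : ℕ

∈⇒1≤∣p∣ : ∀ {p : Subset n} {x} → x ∈ p → 1 ≤ ∣ p ∣
∈⇒1≤∣p∣ x∈p = ≤-trans (s≤s z≤n) (x∈p⇒∣p-x∣<∣p∣ x∈p)

∈⇒2≤∣p∣ : ∀ {p : Subset n} {x y} → x ∈ p → y ∈ p → y ≢ x → 2 ≤ ∣ p ∣
∈⇒2≤∣p∣ x∈p y∈p y≢x =
  ≤-trans (s≤s (∈⇒1≤∣p∣ (x∈p∧x≢y⇒x∈p-y y∈p y≢x))) (x∈p⇒∣p-x∣<∣p∣ x∈p)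

∈⇒3≤∣p∣ : ∀ {p : Subset n} {x y z} → x ∈ p → y ∈ p → z ∈ p →
          y ≢ x → z ≢ x → z ≢ y → 3 ≤ ∣ p ∣
∈⇒3≤∣p∣ x∈p y∈p z∈p y≢x z≢x z≢y =
  ≤-trans (s≤s (∈⇒2≤∣p∣ (x∈p∧x≢y⇒x∈p-y y∈p y≢x) (x∈p∧x≢y⇒x∈p-y z∈p z≢x) z≢y))
          (x∈p⇒∣p-x∣<∣p∣ x∈p)

∣p∪q∣≤∣p∣+∣q∣ : (p q : Subset n) → ∣ p ∪ q ∣ ≤ ∣ p ∣ + ∣ q ∣
∣p∪q∣≤∣p∣+∣q∣ [] [] = z≤n
∣p∪q∣≤∣p∣+∣q∣ (inside ∷ p) (inside ∷ q) =
  s≤s (≤-trans (∣p∪q∣≤∣p∣+∣q∣ p q) (+-monoʳ-≤ ∣ p ∣ (n≤1+n ∣ q ∣)))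
∣p∪q∣≤∣p∣+∣q∣ (inside ∷ p) (outside ∷ q) = s≤s (∣p∪q∣≤∣p∣+∣q∣ p q)
∣p∪q∣≤∣p∣+∣q∣ (outside ∷ p) (inside ∷ q) rewrite +-suc ∣ p ∣ ∣ q ∣ = s≤s (∣p∪q∣≤∣p∣+∣q∣ p q)
∣p∪q∣≤∣p∣+∣q∣ (outside ∷ p) (outside ∷ q) = ∣p∪q∣≤∣p∣+∣q∣ p q

∣⁅x⁆∪⁅y⁆∣≤2 : (x y : Fin n) → ∣ ⁅ x ⁆ ∪ ⁅ y ⁆ ∣ ≤ 2
∣⁅x⁆∪⁅y⁆∣≤2 x y = subst (∣ ⁅ x ⁆ ∪ ⁅ y ⁆ ∣ ≤_)
  (cong₂ _+_ (∣⁅x⁆∣≡1 x) (∣⁅x⁆∣≡1 y)) (∣p∪q∣≤∣p∣+∣q∣ ⁅ x ⁆ ⁅ y ⁆)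

∣⁅x⁆∪⁅y⁆∪⁅z⁆∣≤3 : (x y z : Fin n) → ∣ ⁅ x ⁆ ∪ ⁅ y ⁆ ∪ ⁅ z ⁆ ∣ ≤ 3
∣⁅x⁆∪⁅y⁆∪⁅z⁆∣≤3 x y z = ≤-trans (∣p∪q∣≤∣p∣+∣q∣ ⁅ x ⁆ (⁅ y ⁆ ∪ ⁅ z ⁆))
  (subst (λ k → k + ∣ ⁅ y ⁆ ∪ ⁅ z ⁆ ∣ ≤ 3) (sym (∣⁅x⁆∣≡1 x)) (s≤s (∣⁅x⁆∪⁅y⁆∣≤2 y z)))

x∈⁅x⁆∪p : ∀ {x} {p : Subset n} → x ∈ ⁅ x ⁆ ∪ p
x∈⁅x⁆∪p {x = x} {p = p} = p⊆p∪q p (x∈⁅x⁆ x)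

x∈p∪⁅x⁆ : ∀ {x} {p : Subset n} → x ∈ p ∪ ⁅ x ⁆
x∈p∪⁅x⁆ {x = x} {p = p} = q⊆p∪q p ⁅ x ⁆ (x∈⁅x⁆ x)

T-≟ : (a b : Fin n) → T ⌊ a ≟ b ⌋ ⇔ (a ≡ b)
T-≟ a b = mk⇔ toWitness fromWitness

T-≡ᵇ : ∀ {m k} → T (m ≡ᵇ k) ⇔ (m ≡ k)
T-≡ᵇ = mk⇔ (≡ᵇ⇒≡ _ _) (≡⇒≡ᵇ _ _)

T-not : ∀ {b} → T (not b) ⇔ (¬ T b)
T-not {false} = mk⇔ (λ _ ()) (λ _ → _)
T-not {true} = mk⇔ (λ ()) (λ ¬T → ¬T _)

¬-⇔ : ∀ {A B : Set} → A ⇔ B → (¬ A) ⇔ (¬ B)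
¬-⇔ A⇔B = mk⇔ (λ ¬a → ¬a ∘ from A⇔B) (λ ¬b → ¬b ∘ to A⇔B)

Irreflexive : Graph n → Set
Irreflexive {n} G = (a : Fin n) → ¬ Adj G a a

Dominated : Graph n → Subset n → Fin n → Set
Dominated G S x = ∃ λ y → y ∈ S × Adj G x y

Universal : Graph n → Fin n → Set
Universal {n} G c = (a : Fin n) → a ≢ c → Adj G a c × Adj G c a

module _ {G : Graph n} where

  Adj⇔T : ∀ {x y b} → G x y ≡ b → Adj G x y ⇔ T b
  Adj⇔T eq = mk⇔ (λ adj → from T-≡ (trans (sym eq) adj)) (λ Tb → trans eq (to T-≡ Tb))

  GammaT-intro : ∀ {k} {S : Subset n} → IsTDS G S → ∣ S ∣ ≤ k →
                 ((S′ : Subset n) → IsTDS G S′ → k ≤ ∣ S′ ∣) → GammaT G k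
  GammaT-intro {S = S} tds ∣S∣≤k minimal = (S , tds , ≤-antisym ∣S∣≤k (minimal S tds)) , minimal

  adj⇒≢ : ∀ {x y z} → Adj G x y → ¬ Adj G x z → y ≢ z
  adj⇒≢ xy ¬xz refl = ¬xz xy

  dominated-avoiding⇒3≤∣S∣ : ∀ {S x y z} → x ∈ S → y ∈ S → y ≢ x → Dominated G S z →
                             ¬ Adj G z x → ¬ Adj G z y → 3 ≤ ∣ S ∣
  dominated-avoiding⇒3≤∣S∣ x∈S y∈S y≢x (r , r∈S , zr) ¬zx ¬zy =
    ∈⇒3≤∣p∣ x∈S y∈S r∈S y≢x (adj⇒≢ zr ¬zx) (adj⇒≢ zr ¬zy)

  irreflexive⇒2≤∣tds∣ : Irreflexive G → Fin n → (S : Subset n) → IsTDS G S → 2 ≤ ∣ S ∣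
  irreflexive⇒2≤∣tds∣ irreflexive x S tds with tds x
  ... | y , y∈S , _ with tds y
  ...   | z , z∈S , yz = ∈⇒2≤∣p∣ y∈S z∈S (adj⇒≢ yz (irreflexive y))

  universal⇒GammaT≡2 : Irreflexive G → ∀ {c d} → Universal G c → d ≢ c → GammaT G 2
  universal⇒GammaT≡2 irreflexive {c} {d} universal d≢c =
    GammaT-intro tds (∣⁅x⁆∪⁅y⁆∣≤2 c d) (irreflexive⇒2≤∣tds∣ irreflexive c)
    where
    tds : IsTDS G (⁅ c ⁆ ∪ ⁅ d ⁆)
    tds a with a ≟ c
    ... | yes refl = d , x∈p∪⁅x⁆ , proj₂ (universal d d≢c)
    ... | no a≢c = c , x∈⁅x⁆∪p , proj₁ (universal a a≢c)

  ¬increases : ∀ {u v t k} {S : Subset (n + t)} →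
               ((S′ : Subset n) → IsTDS G S′ → k ≤ ∣ S′ ∣) →
               IsTDS (subdivide G u v t) S → ∣ S ∣ ≤ k → ¬ Increases G u v t
  ¬increases {S = S} k≤γ tds ∣S∣≤k (a , b , (_ , a≤) , ((S′ , tds′ , refl) , _) , b<a) =
    <⇒≱ b<a (≤-trans (a≤ S tds) (≤-trans ∣S∣≤k (k≤γ S′ tds′)))

module Subdivision {n : ℕ} (G : Graph n) (u v : Fin n) (t : ℕ) where

  H : Graph (n + t)
  H = subdivide G u v t

  old : Fin n → Fin (n + t)
  old a = a ↑ˡ t

  new : Fin t → Fin (n + t)
  new j = n ↑ʳ j

  data View : Fin (n + t) → Set where
    is-old : (a : Fin n) → View (old a)
    is-new : (j : Fin t) → View (new j)

  view : (x : Fin (n + t)) → View x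
  view x with splitAt n x in eq
  ... | inj₁ a = subst View (splitAt⁻¹-↑ˡ eq) (is-old a)
  ... | inj₂ j = subst View (splitAt⁻¹-↑ʳ eq) (is-new j)

  old≢new : ∀ {a j} → old a ≢ new j
  old≢new {a} {j} eq
    with () ← trans (sym (splitAt-↑ˡ n a t)) (trans (cong (splitAt n) eq) (splitAt-↑ʳ n t j))

  IsTDS-by-view : ∀ {S} → (∀ a → Dominated H S (old a)) → (∀ j → Dominated H S (new j)) →
                  IsTDS H S
  IsTDS-by-view old-dominated new-dominated x with view x
  ... | is-old a = old-dominated a
  ... | is-new j = new-dominated j

  private
    T-≡∧≡ : (a b c d : Fin n) → T (⌊ a ≟ b ⌋ ∧ ⌊ c ≟ d ⌋) ⇔ (a ≡ b × c ≡ d)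
    T-≡∧≡ a b c d = (T-≟ a b ×-⇔ T-≟ c d) ⇔-∘ T-∧

    T-≡∧≡ᵇ : (a b : Fin n) {m k : ℕ} → T (⌊ a ≟ b ⌋ ∧ (m ≡ᵇ k)) ⇔ (a ≡ b × m ≡ k)
    T-≡∧≡ᵇ a b = (T-≟ a b ×-⇔ T-≡ᵇ) ⇔-∘ T-∧

  adj-old-old : ∀ {a b} → Adj H (old a) (old b) ⇔
                (Adj G a b × ¬ ((a ≡ u × b ≡ v) ⊎ (a ≡ v × b ≡ u)))
  adj-old-old {a} {b} =
    ((T-≡ ×-⇔ (¬-⇔ ((T-≡∧≡ a u b v ⊎-⇔ T-≡∧≡ a v b u) ⇔-∘ T-∨) ⇔-∘ T-not)) ⇔-∘ T-∧)
      ⇔-∘ Adj⇔T {G = H} H-old-old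
    where
    H-old-old : H (old a) (old b) ≡ G a b ∧ not ((⌊ a ≟ u ⌋ ∧ ⌊ b ≟ v ⌋) ∨ (⌊ a ≟ v ⌋ ∧ ⌊ b ≟ u ⌋))
    H-old-old rewrite splitAt-↑ˡ n a t | splitAt-↑ˡ n b t = refl

  adj-old-new : ∀ {a j} → Adj H (old a) (new j) ⇔
                ((a ≡ u × toℕ j ≡ 0) ⊎ (a ≡ v × toℕ j ≡ t ∸ 1))
  adj-old-new {a} {j} = ((T-≡∧≡ᵇ a u ⊎-⇔ T-≡∧≡ᵇ a v) ⇔-∘ T-∨) ⇔-∘ Adj⇔T {G = H} H-old-new
    where
    H-old-new : H (old a) (new j) ≡ (⌊ a ≟ u ⌋ ∧ (toℕ j ≡ᵇ 0)) ∨ (⌊ a ≟ v ⌋ ∧ (toℕ j ≡ᵇ t ∸ 1))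
    H-old-new rewrite splitAt-↑ˡ n a t | splitAt-↑ʳ n t j = refl

  adj-new-old : ∀ {j a} → Adj H (new j) (old a) ⇔
                ((a ≡ u × toℕ j ≡ 0) ⊎ (a ≡ v × toℕ j ≡ t ∸ 1))
  adj-new-old {j} {a} = ((T-≡∧≡ᵇ a u ⊎-⇔ T-≡∧≡ᵇ a v) ⇔-∘ T-∨) ⇔-∘ Adj⇔T {G = H} H-new-old
    where
    H-new-old : H (new j) (old a) ≡ (⌊ a ≟ u ⌋ ∧ (toℕ j ≡ᵇ 0)) ∨ (⌊ a ≟ v ⌋ ∧ (toℕ j ≡ᵇ t ∸ 1))
    H-new-old rewrite splitAt-↑ˡ n a t | splitAt-↑ʳ n t j = refl

  adj-new-new : ∀ {i j} → Adj H (new i) (new j) ⇔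
                (suc (toℕ i) ≡ toℕ j ⊎ suc (toℕ j) ≡ toℕ i)
  adj-new-new {i} {j} = ((T-≡ᵇ ⊎-⇔ T-≡ᵇ) ⇔-∘ T-∨) ⇔-∘ Adj⇔T {G = H} H-new-new
    where
    H-new-new : H (new i) (new j) ≡ (suc (toℕ i) ≡ᵇ toℕ j) ∨ (suc (toℕ j) ≡ᵇ toℕ i)
    H-new-new rewrite splitAt-↑ʳ n t i | splitAt-↑ʳ n t j = refl

module _ {G : Graph n} {c : Fin n} (universal : Universal G c) {u v : Fin n} {t : ℕ} where

  open Subdivision G u v t

  old-dominated-off-edge : c ≢ u → c ≢ v → ∀ {S} → old c ∈ S → old u ∈ S →
                           ∀ a → Dominated H S (old a)
  old-dominated-off-edge c≢u c≢v c∈S u∈S a with a ≟ c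
  ... | yes refl = old u , u∈S ,
        from adj-old-old (proj₂ (universal u (c≢u ∘ sym)) , [ c≢u ∘ proj₁ , c≢v ∘ proj₁ ]′)
  ... | no a≢c = old c , c∈S ,
        from adj-old-old (proj₁ (universal a a≢c) , [ c≢v ∘ proj₂ , c≢u ∘ proj₂ ]′)

  old-dominated-on-edge : c ≡ u ⊎ c ≡ v → ∀ {S} → old c ∈ S →
                          Dominated H S (old u) → Dominated H S (old v) →
                          ∀ a → Dominated H S (old a)
  old-dominated-on-edge c∈uv c∈S u-dominated v-dominated a with a ≟ u | a ≟ v
  ... | yes refl | _ = u-dominated
  ... | no _ | yes refl = v-dominated
  ... | no a≢u | no a≢v = old c , c∈S ,
        from adj-old-old (proj₁ (universal a a≢c) , [ a≢u ∘ proj₁ , a≢v ∘ proj₁ ]′)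
    where
    a≢c : a ≢ c
    a≢c a≡c = [ a≢u ∘ trans a≡c , a≢v ∘ trans a≡c ]′ c∈uv

on-edge? : (c u v : Fin n) → (c ≡ u ⊎ c ≡ v) ⊎ (c ≢ u × c ≢ v)
on-edge? c u v with c ≟ u | c ≟ v
... | yes c≡u | _ = inj₁ (inj₁ c≡u)
... | no _ | yes c≡v = inj₁ (inj₂ c≡v)
... | no c≢u | no c≢v = inj₂ (c≢u , c≢v)

module _ {G : Graph n} {c : Fin n} (universal : Universal G c) (u v : Fin n) where

  module _ where
    open Subdivision G u v 1

    tds-subdivide₁-on-edge : c ≡ u ⊎ c ≡ v → IsTDS H (⁅ old c ⁆ ∪ ⁅ new zero ⁆)
    tds-subdivide₁-on-edge c∈uv = IsTDS-by-view
      (old-dominated-on-edge universal c∈uv x∈⁅x⁆∪p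
        (new zero , x∈p∪⁅x⁆ , from adj-old-new (inj₁ (refl , refl)))
        (new zero , x∈p∪⁅x⁆ , from adj-old-new (inj₂ (refl , refl))))
      λ { zero → old c , x∈⁅x⁆∪p , from adj-new-old (map (_, refl) (_, refl) c∈uv) }

    tds-subdivide₁-off-edge : c ≢ u → c ≢ v → IsTDS H (⁅ old c ⁆ ∪ ⁅ old u ⁆)
    tds-subdivide₁-off-edge c≢u c≢v = IsTDS-by-view
      (old-dominated-off-edge universal c≢u c≢v x∈⁅x⁆∪p x∈p∪⁅x⁆)
      λ { zero → old u , x∈p∪⁅x⁆ , from adj-new-old (inj₁ (refl , refl)) }

    tds≤2-subdivide₁ : Σ (Subset (n + 1)) λ S → IsTDS H S × ∣ S ∣ ≤ 2
    tds≤2-subdivide₁ with on-edge? c u v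
    ... | inj₁ c∈uv = _ , tds-subdivide₁-on-edge c∈uv , ∣⁅x⁆∪⁅y⁆∣≤2 (old c) (new zero)
    ... | inj₂ (c≢u , c≢v) = _ , tds-subdivide₁-off-edge c≢u c≢v , ∣⁅x⁆∪⁅y⁆∣≤2 (old c) (old u)

  module _ where
    open Subdivision G u v 2

    tds-subdivide₂-on-edge : c ≡ u ⊎ c ≡ v →
                             IsTDS H (⁅ old c ⁆ ∪ ⁅ new zero ⁆ ∪ ⁅ new (suc zero) ⁆)
    tds-subdivide₂-on-edge c∈uv = IsTDS-by-view
      (old-dominated-on-edge universal c∈uv x∈⁅x⁆∪p
        (new zero , q⊆p∪q _ _ x∈⁅x⁆∪p , from adj-old-new (inj₁ (refl , refl)))
        (new (suc zero) , q⊆p∪q _ _ x∈p∪⁅x⁆ , from adj-old-new (inj₂ (refl , refl))))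
      λ { zero → new (suc zero) , q⊆p∪q _ _ x∈p∪⁅x⁆ , from adj-new-new (inj₁ refl)
        ; (suc zero) → new zero , q⊆p∪q _ _ x∈⁅x⁆∪p , from adj-new-new (inj₂ refl) }

    tds-subdivide₂-off-edge : c ≢ u → c ≢ v → IsTDS H (⁅ old c ⁆ ∪ ⁅ old u ⁆ ∪ ⁅ old v ⁆)
    tds-subdivide₂-off-edge c≢u c≢v = IsTDS-by-view
      (old-dominated-off-edge universal c≢u c≢v x∈⁅x⁆∪p (q⊆p∪q _ _ x∈⁅x⁆∪p))
      λ { zero → old u , q⊆p∪q _ _ x∈⁅x⁆∪p , from adj-new-old (inj₁ (refl , refl))
        ; (suc zero) → old v , q⊆p∪q _ _ x∈p∪⁅x⁆ , from adj-new-old (inj₂ (refl , refl)) }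

    tds≤3-subdivide₂ : Σ (Subset (n + 2)) λ S → IsTDS H S × ∣ S ∣ ≤ 3
    tds≤3-subdivide₂ with on-edge? c u v
    ... | inj₁ c∈uv =
      _ , tds-subdivide₂-on-edge c∈uv , ∣⁅x⁆∪⁅y⁆∪⁅z⁆∣≤3 (old c) (new zero) (new (suc zero))
    ... | inj₂ (c≢u , c≢v) =
      _ , tds-subdivide₂-off-edge c≢u c≢v , ∣⁅x⁆∪⁅y⁆∪⁅z⁆∣≤3 (old c) (old u) (old v)

module _ {G : Graph n} (irreflexive : Irreflexive G) {u v w : Fin n}
         (u≢v : u ≢ v) (w≢u : w ≢ u) (w≢v : w ≢ v) where

  open Subdivision G u v 2

  private
    x₁ x₂ : Fin (n + 2)
    x₁ = new zero
    x₂ = new (suc zero)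

    neighbours-x₁ : ∀ {y} → Adj H x₁ y → y ≡ old u ⊎ y ≡ x₂
    neighbours-x₁ {y} adj with view y
    ... | is-old a = inj₁ (cong old ([ proj₁ , (λ ()) ∘ proj₂ ]′ (to adj-new-old adj)))
    ... | is-new zero = [ (λ ()) , (λ ()) ]′ (to adj-new-new adj)
    ... | is-new (suc zero) = inj₂ refl

    neighbours-x₂ : ∀ {y} → Adj H x₂ y → y ≡ x₁ ⊎ y ≡ old v
    neighbours-x₂ {y} adj with view y
    ... | is-old a = inj₂ (cong old ([ (λ ()) ∘ proj₂ , proj₁ ]′ (to adj-new-old adj)))
    ... | is-new zero = inj₁ refl
    ... | is-new (suc zero) = [ (λ ()) , (λ ()) ]′ (to adj-new-new adj)

    ¬adj-u-v : ¬ Adj H (old u) (old v)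
    ¬adj-u-v adj = proj₂ (to adj-old-old adj) (inj₁ (refl , refl))

    ¬adj-v-u : ¬ Adj H (old v) (old u)
    ¬adj-v-u adj = proj₂ (to adj-old-old adj) (inj₂ (refl , refl))

    ¬adj-u-u : ¬ Adj H (old u) (old u)
    ¬adj-u-u = irreflexive u ∘ proj₁ ∘ to adj-old-old

    ¬adj-old-new : ∀ {a j} → a ≢ u → a ≢ v → ¬ Adj H (old a) (new j)
    ¬adj-old-new a≢u a≢v = [ a≢u ∘ proj₁ , a≢v ∘ proj₁ ]′ ∘ to adj-old-new

    ¬adj-v-x₁ : ¬ Adj H (old v) x₁
    ¬adj-v-x₁ = [ u≢v ∘ sym ∘ proj₁ , (λ ()) ∘ proj₂ ]′ ∘ to adj-old-new

    ¬adj-u-x₂ : ¬ Adj H (old u) x₂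
    ¬adj-u-x₂ = [ (λ ()) ∘ proj₂ , u≢v ∘ proj₁ ]′ ∘ to adj-old-new

  -- x₁ must be dominated by u or x₂, and x₂ by x₁ or v; in each of the four cases some
  -- old vertex (v, u, w or u) is adjacent to neither chosen dominator.
  3≤∣tds-subdivide₂∣ : (S : Subset (n + 2)) → IsTDS H S → 3 ≤ ∣ S ∣
  3≤∣tds-subdivide₂∣ S tds with tds x₁ | tds x₂
  ... | p , p∈S , x₁p | q , q∈S , x₂q with neighbours-x₁ x₁p | neighbours-x₂ x₂q
  ... | inj₁ refl | inj₁ refl =
    dominated-avoiding⇒3≤∣S∣ {G = H} p∈S q∈S (old≢new ∘ sym) (tds (old v)) ¬adj-v-u ¬adj-v-x₁
  ... | inj₁ refl | inj₂ refl =
    dominated-avoiding⇒3≤∣S∣ {G = H} p∈S q∈S (u≢v ∘ sym ∘ ↑ˡ-injective 2 v u)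
      (tds (old u)) ¬adj-u-u ¬adj-u-v
  ... | inj₂ refl | inj₁ refl =
    dominated-avoiding⇒3≤∣S∣ {G = H} p∈S q∈S
      (λ x₁≡x₂ → case ↑ʳ-injective n zero (suc zero) x₁≡x₂ of λ ())
      (tds (old w)) (¬adj-old-new w≢u w≢v) (¬adj-old-new w≢u w≢v)
  ... | inj₂ refl | inj₂ refl =
    dominated-avoiding⇒3≤∣S∣ {G = H} p∈S q∈S old≢new (tds (old u)) ¬adj-u-x₂ ¬adj-u-v

∃-avoiding : ∀ {m} (u v : Fin (3 + m)) → ∃ λ w → w ≢ u × w ≢ v
∃-avoiding zero zero = suc zero , (λ ()) , (λ ())
∃-avoiding zero (suc zero) = suc (suc zero) , (λ ()) , (λ ())
∃-avoiding zero (suc (suc v)) = suc zero , (λ ()) , (λ ())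
∃-avoiding (suc zero) zero = suc (suc zero) , (λ ()) , (λ ())
∃-avoiding (suc zero) (suc v) = zero , (λ ()) , (λ ())
∃-avoiding (suc (suc u)) zero = suc zero , (λ ()) , (λ ())
∃-avoiding (suc (suc u)) (suc v) = zero , (λ ()) , (λ ())

module _ {m : ℕ} {G : Graph (3 + m)} (irreflexive : Irreflexive G)
         {c : Fin (3 + m)} (universal : Universal G c) where

  GammaT≡2 : GammaT G 2
  GammaT≡2 = let d , d≢c , _ = ∃-avoiding c c in universal⇒GammaT≡2 irreflexive universal d≢c

  msd-edge≡2 : ∀ {u v} → Adj G u v → MsdEdge G u v 2
  msd-edge≡2 {u} {v} uv = s≤s z≤n , increases , ¬increases-below
    where
    u≢v : u ≢ v
    u≢v refl = irreflexive u uv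

    increases : Increases G u v 2
    increases =
      let S , tds , ∣S∣≤3 = tds≤3-subdivide₂ universal u v
          w , w≢u , w≢v = ∃-avoiding u v
      in 3 , 2 , GammaT-intro tds ∣S∣≤3 (3≤∣tds-subdivide₂∣ irreflexive u≢v w≢u w≢v) ,
         GammaT≡2 , ≤-refl

    ¬increases-below : ∀ s → 1 ≤ s → s < 2 → ¬ Increases G u v s
    ¬increases-below 1 _ _ =
      let S , tds , ∣S∣≤2 = tds≤2-subdivide₁ universal u v
      in ¬increases (irreflexive⇒2≤∣tds∣ irreflexive c) tds ∣S∣≤2
    ¬increases-below (suc (suc _)) _ (s≤s (s≤s ()))

  msd≡2 : Msd G 2
  msd≡2 =
    let d , d≢c , _ = ∃-avoiding c c
        cd = proj₂ (universal d d≢c)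
    in (λ _ _ uv → 2 , msd-edge≡2 uv , ≤-refl) , c , d , cd , msd-edge≡2 cd

complete-irreflexive : Irreflexive (complete n)
complete-irreflexive a adj with a ≟ a
... | yes _ = case adj of λ ()
... | no a≢a = a≢a refl

complete-universal : Universal (complete (suc n)) zero
complete-universal a a≢0 with a ≟ zero | zero ≟ a
... | yes a≡0 | _ = contradiction a≡0 a≢0
... | no _ | yes 0≡a = contradiction (sym 0≡a) a≢0
... | no _ | no _ = refl , refl

star-irreflexive : Irreflexive (star n)
star-irreflexive zero ()
star-irreflexive (suc a) ()

star-universal : Universal (star (suc n)) zero
star-universal zero 0≢0 = contradiction refl 0≢0
star-universal (suc a) _ = refl , refl

wheel-irreflexive : ∀ {k} → Irreflexive (wheel (4 + k))
wheel-irreflexive zero ()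
wheel-irreflexive {k} (suc a) =
  [ ¬T-suc≡ᵇ , [ ¬T-suc≡ᵇ , [ ¬T-wrap-around , ¬T-wrap-around ]′ ∘ to T-∨ ]′ ∘ to T-∨ ]′
    ∘ to T-∨ ∘ from T-≡
  where
  s : ℕ
  s = suc (toℕ a)

  ¬T-suc≡ᵇ : ¬ T (suc s ≡ᵇ s)
  ¬T-suc≡ᵇ = 1+n≢n ∘ ≡ᵇ⇒≡ (suc s) s

  ¬T-wrap-around : ¬ T ((s ≡ᵇ 1) ∧ (s ≡ᵇ 3 + k))
  ¬T-wrap-around p with to T-∧ p
  ... | s≡1 , s≡3+k = case trans (sym (≡ᵇ⇒≡ s 1 s≡1)) (≡ᵇ⇒≡ s (3 + k) s≡3+k) of λ ()

wheel-universal : Universal (wheel (suc n)) zero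
wheel-universal zero 0≢0 = contradiction refl 0≢0
wheel-universal (suc a) _ = refl , refl

corollary5 : ((n : ℕ) → 3 ≤ n → Msd (complete n) 2) ×
    ((n : ℕ) → 3 ≤ n → Msd (star n) 2) ×
    ((n : ℕ) → 4 ≤ n → Msd (wheel n) 2)
corollary5 = complete-msd≡2 , star-msd≡2 , wheel-msd≡2
  where
  complete-msd≡2 : (n : ℕ) → 3 ≤ n → Msd (complete n) 2
  complete-msd≡2 (suc (suc (suc _))) (s≤s (s≤s (s≤s _))) =
    msd≡2 complete-irreflexive complete-universal

  star-msd≡2 : (n : ℕ) → 3 ≤ n → Msd (star n) 2
  star-msd≡2 (suc (suc (suc _))) (s≤s (s≤s (s≤s _))) = msd≡2 star-irreflexive star-universal

  wheel-msd≡2 : (n : ℕ) → 4 ≤ n → Msd (wheel n) 2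
  wheel-msd≡2 (suc (suc (suc (suc _)))) (s≤s (s≤s (s≤s (s≤s _)))) =
    msd≡2 wheel-irreflexive wheel-universal
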